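{- In the calculus with synchronisation described in the context, if $P\sim Q$, then for every substitution $\sigma$ (a function from names to names), $P\sigma\sim Q\sigma$, where $P\sigma$ is obtained by applying $\sigma$ to all names of $P$.
   Context: Let $a$ range over a countable set of names; actions are $\alpha::= a\mid \bar a$. Finite processes: $F ::= 0 \mid \alpha.F \mid F|F$. Processes: $P ::= F \mid\ !\alpha.F \mid P|P$. Transitions: $\alpha.F\xrightarrow{\alpha}F$; $!\alpha.F\xrightarrow{\alpha}\ !\alpha.F|F$; if $P_1\xrightarrow{\mu}P_1'$ then $P_1|P_2\xrightarrow{\mu}P_1'|P_2$ and $P_2|P_1\xrightarrow{\mu}P_2|P_1'$; if $P\xrightarrow{a}P'$ and $Q\xrightarrow{\bar a}Q'$ then $P|Q\xrightarrow{\tau}P'|Q'$ and $Q|P\xrightarrow{\tau}Q'|P'$. Here $\sim$ denotes bisimilarity on visible labels only: the largest symmetric relation $\mathcal R$ such that $P\mathcal RQ$ and $P\xrightarrow{\alpha}P'$ with $\alpha\in\{a,\bar a\}$ imply $Q\xrightarrow{\alpha}Q'$ with $P'\mathcal RQ'$ ($\tau$-transitions are not tested). -}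

module Defs where

open import Data.Nat using (ℕ)
open import Data.Product using (Σ; _×_; _,_)
open import Level using (0ℓ)
open import Relation.Binary.Core using (Rel)
open import Relation.Binary.Definitions using (Symmetric)

Name : Set
Name = ℕ

data Act : Set where
  inp : Name → Act
  out : Name → Act

co : Act → Act
co (inp a) = out a
co (out a) = inp a

data Label : Set where
  vis : Act → Label
  τ   : Label

data FProc : Set where
  𝟘    : FProc
  _∙_  : Act → FProc → FProc
  _∣_  : FProc → FProc → FProc

data Proc : Set where
  fin  : FProc → Proc
  rep  : Act → FProc → Proc
  _∥_  : Proc → Proc → Proc

-- Note that fin (F ∣ G) is the process F|G built
-- from the finite-process grammar; the transition rules below treat
-- it as a parallel composition exactly as for _∥_.

data _—[_]→_ : Proc → Label → Proc → Set where
  pre   : ∀ {α F} → fin (α ∙ F) —[ vis α ]→ fin F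
  bang  : ∀ {α F} → rep α F —[ vis α ]→ (rep α F ∥ fin F)
  parL  : ∀ {P₁ P₁' P₂ μ} → P₁ —[ μ ]→ P₁' → (P₁ ∥ P₂) —[ μ ]→ (P₁' ∥ P₂)
  parR  : ∀ {P₁ P₁' P₂ μ} → P₁ —[ μ ]→ P₁' → (P₂ ∥ P₁) —[ μ ]→ (P₂ ∥ P₁')
  comL  : ∀ {P P' Q Q' a} → P —[ vis (inp a) ]→ P' → Q —[ vis (out a) ]→ Q'
        → (P ∥ Q) —[ τ ]→ (P' ∥ Q')
  comR  : ∀ {P P' Q Q' a} → P —[ vis (inp a) ]→ P' → Q —[ vis (out a) ]→ Q'
        → (Q ∥ P) —[ τ ]→ (Q' ∥ P')
  fparL : ∀ {F₁ F₁' F₂ μ} → fin F₁ —[ μ ]→ fin F₁'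
        → fin (F₁ ∣ F₂) —[ μ ]→ fin (F₁' ∣ F₂)
  fparR : ∀ {F₁ F₁' F₂ μ} → fin F₁ —[ μ ]→ fin F₁'
        → fin (F₂ ∣ F₁) —[ μ ]→ fin (F₂ ∣ F₁')
  fcomL : ∀ {F F' G G' a} → fin F —[ vis (inp a) ]→ fin F' → fin G —[ vis (out a) ]→ fin G'
        → fin (F ∣ G) —[ τ ]→ fin (F' ∣ G')
  fcomR : ∀ {F F' G G' a} → fin F —[ vis (inp a) ]→ fin F' → fin G —[ vis (out a) ]→ fin G'
        → fin (G ∣ F) —[ τ ]→ fin (G' ∣ F')

record IsBisimulation (R : Rel Proc 0ℓ) : Set where
  field
    sym  : Symmetric R
    step : ∀ {P Q P'} (α : Act) → R P Q → P —[ vis α ]→ P'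
         → Σ Proc (λ Q' → (Q —[ vis α ]→ Q') × R P' Q')

-- Bisimilarity: the largest bisimulation, i.e. the union of all bisimulations.
_∼_ : Proc → Proc → Set₁
P ∼ Q = Σ (Rel Proc 0ℓ) (λ R → IsBisimulation R × R P Q)

Subst : Set
Subst = Name → Name

actσ : Act → Subst → Act
actσ (inp a) σ = inp (σ a)
actσ (out a) σ = out (σ a)

fprocσ : FProc → Subst → FProc
fprocσ 𝟘 σ = 𝟘
fprocσ (α ∙ F) σ = actσ α σ ∙ fprocσ F σ
fprocσ (F ∣ G) σ = fprocσ F σ ∣ fprocσ G σ

_[_] : Proc → Subst → Proc
fin F [ σ ] = fin (fprocσ F σ)
rep α F [ σ ] = rep (actσ α σ) (fprocσ F σ)
(P ∥ Q) [ σ ] = (P [ σ ]) ∥ (Q [ σ ])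

module Submission where

-- Every visible transition of P σ is the image of a transition of P (τ is
-- never tested, so the synchronisations that a non-injective σ may create
-- are irrelevant).  Hence the σ-image of a bisimulation is a bisimulation.

open import Defs
open import Data.Product using (Σ; _×_; _,_)
open import Level using (0ℓ)
open import Relation.Binary.Core using (Rel)

[]-preserves-—→ : ∀ {P P′ α} (σ : Subst) →
                  P —[ vis α ]→ P′ → (P [ σ ]) —[ vis (actσ α σ) ]→ (P′ [ σ ])
[]-preserves-—→ σ pre       = pre
[]-preserves-—→ σ bang      = bang
[]-preserves-—→ σ (parL t)  = parL ([]-preserves-—→ σ t)
[]-preserves-—→ σ (parR t)  = parR ([]-preserves-—→ σ t)
[]-preserves-—→ σ (fparL t) = fparL ([]-preserves-—→ σ t)
[]-preserves-—→ σ (fparR t) = fparR ([]-preserves-—→ σ t)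

data FinPreimage (σ : Subst) (F : FProc) : Act → Proc → Set where
  preimage : ∀ {α G} → fin F —[ vis α ]→ fin G →
             FinPreimage σ F (actσ α σ) (fin (fprocσ G σ))

data Preimage (σ : Subst) (P : Proc) : Act → Proc → Set where
  preimage : ∀ {α P′} → P —[ vis α ]→ P′ → Preimage σ P (actσ α σ) (P′ [ σ ])

fprocσ-reflects-—→ : ∀ {β R} (σ : Subst) (F : FProc) →
                     fin (fprocσ F σ) —[ vis β ]→ R → FinPreimage σ F β R
fprocσ-reflects-—→ σ (α ∙ F) pre = preimage pre
fprocσ-reflects-—→ σ (F ∣ G) (fparL t) with fprocσ-reflects-—→ σ F t
... | preimage t′ = preimage (fparL t′)
fprocσ-reflects-—→ σ (F ∣ G) (fparR t) with fprocσ-reflects-—→ σ G t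
... | preimage t′ = preimage (fparR t′)

[]-reflects-—→ : ∀ {β R} (σ : Subst) (P : Proc) →
                 (P [ σ ]) —[ vis β ]→ R → Preimage σ P β R
[]-reflects-—→ σ (fin F) t with fprocσ-reflects-—→ σ F t
... | preimage t′ = preimage t′
[]-reflects-—→ σ (rep α F) bang = preimage bang
[]-reflects-—→ σ (P ∥ Q) (parL t) with []-reflects-—→ σ P t
... | preimage t′ = preimage (parL t′)
[]-reflects-—→ σ (P ∥ Q) (parR t) with []-reflects-—→ σ Q t
... | preimage t′ = preimage (parR t′)

data SubstImage (σ : Subst) (R : Rel Proc 0ℓ) : Rel Proc 0ℓ where
  image : ∀ {P Q} → R P Q → SubstImage σ R (P [ σ ]) (Q [ σ ])

SubstImage-isBisimulation : ∀ (σ : Subst) {R : Rel Proc 0ℓ} →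
                            IsBisimulation R → IsBisimulation (SubstImage σ R)
SubstImage-isBisimulation σ {R} isBisim = record { sym = symmetric ; step = step }
  where
  open IsBisimulation isBisim renaming (sym to R-sym; step to R-step)

  symmetric : ∀ {X Y} → SubstImage σ R X Y → SubstImage σ R Y X
  symmetric (image r) = image (R-sym r)

  step : ∀ {X Y X′} (β : Act) → SubstImage σ R X Y → X —[ vis β ]→ X′ →
         Σ Proc (λ Y′ → (Y —[ vis β ]→ Y′) × SubstImage σ R X′ Y′)
  step _ (image {P} r) t with []-reflects-—→ σ P t
  ... | preimage t′ with R-step _ r t′
  ...   | Q′ , u , r′ = Q′ [ σ ] , []-preserves-—→ σ u , image r′

proposition5 : ∀ (P Q : Proc) (σ : Subst) → P ∼ Q → (P [ σ ]) ∼ (Q [ σ ])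
proposition5 P Q σ (R , isBisim , r) =
  SubstImage σ R , SubstImage-isBisimulation σ isBisim , image r
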